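{- Let $n$ be an even half-Zumkeller number and $p$ a prime with $\gcd(n,p)=1$. Then $np^l$ is a half-Zumkeller number for every positive integer $l$.
   Context: A positive integer $n$ is a half-Zumkeller number if the set of all positive divisors of $n$ other than $n$ itself can be partitioned into two disjoint parts whose sums are equal. -}

module Defs where

open import Data.Nat using (ℕ; zero; suc; _+_; _*_; _^_; _<_; _≤_; _≥_)
open import Data.Nat.Divisibility using (_∣_; _∣?_)
open import Data.Nat.Properties using (_<?_)
open import Data.List using (List; filter; upTo; map)
open import Data.Nat.ListAction using (sum)
open import Data.Bool using (Bool; true; false; not) renaming (_≟_ to _≟ᵇ_)
open import Data.Product using (Σ; ∃; _×_)
open import Relation.Binary.PropositionalEquality using (_≡_)
open import Relation.Nullary.Decidable using (_×-dec_)

properDivisors : ℕ → List ℕ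
properDivisors n = filter (λ d → (d ∣? n) ×-dec (d <? n)) (map suc (upTo n))

partSum : (ℕ → Bool) → List ℕ → ℕ
partSum f xs = sum (filter (λ d → f d ≟ᵇ true) xs)

HalfZumkeller : ℕ → Set
HalfZumkeller n = 1 ≤ n × Σ (ℕ → Bool) (λ f →
  partSum f (properDivisors n) ≡ partSum (λ d → not (f d)) (properDivisors n))

module Submission where

-- A partition of a list of numbers is a predicate f : ℕ → Bool; it
-- is *balanced* when the selected elements and the rest have equal sums.
--  1. Write n = 2v.  Starting from a balanced partition of the proper divisors
--     of n, move v to the other part and put n = v + v where v was: this
--     balances the full divisor list of n (n is Zumkeller).
--  2. Since p ∤ n, every proper divisor of n * p ^ (l + 1) is either prime to
--     p, hence a divisor of n, or p times a proper divisor of n * p ^ l: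
--        properDivisors (n * p ^ (l + 1)) ↭ divisors n ++ map (p *_) (properDivisors (n * p ^ l)).
--  3. Balanced partitions survive concatenation and scaling by p, so by
--     induction on l the balanced partition of the divisors of n (step 1) and
--     one of the proper divisors of n * p ^ l glue to one of n * p ^ (l + 1).

open import Defs
open import Data.Bool using (Bool; true; false; not; if_then_else_)
open import Data.List using (List; []; _∷_; _++_; [_]; map; filter; upTo)
open import Data.List.Membership.Propositional using (_∈_; _∉_)
open import Data.List.Membership.Propositional.Properties
  using (∈-filter⁺; ∈-filter⁻; ∈-map⁺; ∈-map⁻; ∈-upTo⁺; ∈-++⁺ˡ; ∈-++⁺ʳ; ∈-++⁻)
open import Data.List.Membership.Propositional.Properties.WithK using (unique∧set⇒bag)
open import Data.List.Relation.Binary.BagAndSetEquality using (∼bag⇒↭)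
open import Data.List.Relation.Binary.Permutation.Propositional using (_↭_; ↭-sym; ↭-trans; prep)
open import Data.List.Relation.Binary.Permutation.Propositional.Properties
  using (filter-↭; ++⁺ʳ; ++-comm)
open import Data.List.Relation.Unary.All as All using (All; [])
open import Data.List.Relation.Unary.AllPairs using ([]; _∷_)
open import Data.List.Relation.Unary.Any using (here; there)
open import Data.List.Relation.Unary.Unique.Propositional using (Unique)
import Data.List.Relation.Unary.Unique.Propositional.Properties as Unique
open import Data.Nat
open import Data.Nat.Properties
open import Algebra.Properties.CommutativeSemigroup *-commutativeSemigroup
  using () renaming (x∙yz≈y∙xz to *-leftComm)
open import Data.Nat.Divisibility
open import Data.Nat.DivMod using (m*n/n≡m)
open import Data.Nat.Coprimality using (Coprime; coprime-divisor; gcd≡1⇒coprime)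
open import Data.Nat.GCD using (gcd)
open import Data.Nat.Primality
  using (Prime; prime⇒irreducible; prime⇒nonZero; prime⇒nonTrivial; ¬prime[1])
open import Data.Nat.ListAction.Properties using (sum-↭)
open import Data.Product using (Σ; _×_; _,_; proj₁; proj₂)
open import Data.Sum using (inj₁; inj₂)
open import Function.Bundles using (mk⇔)
open import Relation.Binary.PropositionalEquality using (_≡_; _≢_; refl; sym; trans; cong; cong₂; subst; subst₂; module ≡-Reasoning)
open import Relation.Nullary using (¬_; yes; no; does; contradiction)
open import Relation.Nullary.Decidable using (dec-true; dec-false; ¬?; _×-dec_)

open ≡-Reasoning

weight : Bool → ℕ → ℕ
weight true  x = x
weight false _ = 0

Balanced : (ℕ → Bool) → List ℕ → Set
Balanced f xs = partSum f xs ≡ partSum (λ d → not (f d)) xs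

partSum-∷ : ∀ f x xs → partSum f (x ∷ xs) ≡ weight (f x) x + partSum f xs
partSum-∷ f x xs with f x
... | true  = refl
... | false = refl

partSum-++ : ∀ f xs ys → partSum f (xs ++ ys) ≡ partSum f xs + partSum f ys
partSum-++ f []       ys = refl
partSum-++ f (x ∷ xs) ys = begin
  partSum f (x ∷ xs ++ ys)                      ≡⟨ partSum-∷ f x (xs ++ ys) ⟩
  weight (f x) x + partSum f (xs ++ ys)         ≡⟨ cong (weight (f x) x +_) (partSum-++ f xs ys) ⟩
  weight (f x) x + (partSum f xs + partSum f ys) ≡⟨ +-assoc (weight (f x) x) _ _ ⟨
  weight (f x) x + partSum f xs + partSum f ys  ≡⟨ cong (_+ partSum f ys) (partSum-∷ f x xs) ⟨
  partSum f (x ∷ xs) + partSum f ys             ∎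

partSum-scale : ∀ c f xs → partSum f (map (c *_) xs) ≡ c * partSum (λ x → f (c * x)) xs
partSum-scale c f []       = sym (*-zeroʳ c)
partSum-scale c f (x ∷ xs) = begin
  partSum f (c * x ∷ map (c *_) xs)                    ≡⟨ partSum-∷ f (c * x) _ ⟩
  weight (f (c * x)) (c * x) + partSum f (map (c *_) xs)
    ≡⟨ cong₂ _+_ (weight-scale (f (c * x))) (partSum-scale c f xs) ⟩
  c * weight (f (c * x)) x + c * partSum f′ xs         ≡⟨ *-distribˡ-+ c _ _ ⟨
  c * (weight (f (c * x)) x + partSum f′ xs)           ≡⟨ cong (c *_) (partSum-∷ f′ x xs) ⟨
  c * partSum f′ (x ∷ xs)                              ∎
  where
  f′ : ℕ → Bool
  f′ y = f (c * y)
  weight-scale : ∀ b → weight b (c * x) ≡ c * weight b x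
  weight-scale true  = refl
  weight-scale false = sym (*-zeroʳ c)

partSum-cong : ∀ {f g} xs → (∀ {x} → x ∈ xs → f x ≡ g x) → partSum f xs ≡ partSum g xs
partSum-cong         []       _  = refl
partSum-cong {f} {g} (x ∷ xs) eq = begin
  partSum f (x ∷ xs)              ≡⟨ partSum-∷ f x xs ⟩
  weight (f x) x + partSum f xs   ≡⟨ cong₂ (λ b s → weight b x + s) (eq (here refl))
                                           (partSum-cong xs (λ x∈ → eq (there x∈))) ⟩
  weight (g x) x + partSum g xs   ≡⟨ partSum-∷ g x xs ⟨
  partSum g (x ∷ xs)              ∎

balanced-++ : ∀ {f xs ys} → Balanced f xs → Balanced f ys → Balanced f (xs ++ ys)
balanced-++ {f} {xs} {ys} bx by = begin
  partSum f (xs ++ ys)                                ≡⟨ partSum-++ f xs ys ⟩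
  partSum f xs + partSum f ys                         ≡⟨ cong₂ _+_ bx by ⟩
  partSum f̅ xs + partSum f̅ ys                         ≡⟨ partSum-++ f̅ xs ys ⟨
  partSum f̅ (xs ++ ys)                                ∎
  where
  f̅ : ℕ → Bool
  f̅ d = not (f d)

balanced-scale : ∀ {f} c xs → Balanced (λ x → f (c * x)) xs → Balanced f (map (c *_) xs)
balanced-scale {f} c xs bal = begin
  partSum f (map (c *_) xs)                ≡⟨ partSum-scale c f xs ⟩
  c * partSum (λ x → f (c * x)) xs         ≡⟨ cong (c *_) bal ⟩
  c * partSum (λ x → not (f (c * x))) xs   ≡⟨ partSum-scale c (λ d → not (f d)) xs ⟨
  partSum (λ d → not (f d)) (map (c *_) xs) ∎

balanced-cong : ∀ {f g} xs → (∀ {x} → x ∈ xs → f x ≡ g x) → Balanced f xs → Balanced g xs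
balanced-cong xs eq bal =
  trans (sym (partSum-cong xs eq)) (trans bal (partSum-cong xs (λ x∈ → cong not (eq x∈))))

balanced-↭ : ∀ {f xs ys} → xs ↭ ys → Balanced f xs → Balanced f ys
balanced-↭ xs↭ys bal = trans (sym (partSum-↭ xs↭ys)) (trans bal (partSum-↭ xs↭ys))
  where
  partSum-↭ : ∀ {h xs ys} → xs ↭ ys → partSum h xs ≡ partSum h ys
  partSum-↭ p = sum-↭ (filter-↭ _ p)

unique-↭ : ∀ {xs ys : List ℕ} → Unique xs → Unique ys →
  (∀ {x} → x ∈ xs → x ∈ ys) → (∀ {x} → x ∈ ys → x ∈ xs) → xs ↭ ys
unique-↭ uxs uys to from = ∼bag⇒↭ (unique∧set⇒bag uxs uys (mk⇔ to from))

without : ℕ → List ℕ → List ℕ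
without v = filter (λ x → ¬? (x ≟ v))

∈-without⁻ : ∀ {v x xs} → x ∈ without v xs → x ∈ xs × x ≢ v
∈-without⁻ {v} {xs = xs} = ∈-filter⁻ (λ x → ¬? (x ≟ v)) {xs = xs}

extract : ∀ {v xs} → Unique xs → v ∈ xs → xs ↭ v ∷ without v xs
extract {v} {xs} uxs v∈ = unique-↭ uxs (v∉rest ∷ Unique.filter⁺ _ uxs) to from
  where
  v∉rest : All (v ≢_) (without v xs)
  v∉rest = All.tabulate (λ x∈ v≡x → proj₂ (∈-without⁻ {xs = xs} x∈) (sym v≡x))
  to : ∀ {x} → x ∈ xs → x ∈ v ∷ without v xs
  to {x} x∈ with x ≟ v
  ... | yes refl = here refl
  ... | no x≢v   = there (∈-filter⁺ (λ y → ¬? (y ≟ v)) x∈ x≢v)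
  from : ∀ {x} → x ∈ v ∷ without v xs → x ∈ xs
  from (here refl) = v∈
  from (there x∈)  = proj₁ (∈-without⁻ {xs = xs} x∈)

divisors : ℕ → List ℕ
divisors n = properDivisors n ++ [ n ]

∈-properDivisors⁺ : ∀ {n d} → 1 ≤ n → d ∣ n → d < n → d ∈ properDivisors n
∈-properDivisors⁺ {n} {zero}  n≥1 0∣n _   = contradiction (0∣⇒≡0 0∣n) (>⇒≢ n≥1)
∈-properDivisors⁺ {n} {suc d} _   d∣n d<n =
  ∈-filter⁺ (λ d → (d ∣? n) ×-dec (d <? n)) (∈-map⁺ suc (∈-upTo⁺ (<-trans (n<1+n d) d<n))) (d∣n , d<n)

∈-properDivisors⁻ : ∀ {n d} → d ∈ properDivisors n → d ∣ n × d < n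
∈-properDivisors⁻ {n} d∈ =
  proj₂ (∈-filter⁻ (λ d → (d ∣? n) ×-dec (d <? n)) {xs = map suc (upTo n)} d∈)

unique-properDivisors : ∀ n → Unique (properDivisors n)
unique-properDivisors n = Unique.filter⁺ _ (Unique.map⁺ suc-injective (Unique.upTo⁺ n))

∈-divisors⁺ : ∀ {n d} → 1 ≤ n → d ∣ n → d ∈ divisors n
∈-divisors⁺ {n} {d} n≥1 d∣n with m≤n⇒m<n∨m≡n (∣⇒≤ {{>-nonZero n≥1}} d∣n)
... | inj₁ d<n  = ∈-++⁺ˡ (∈-properDivisors⁺ n≥1 d∣n d<n)
... | inj₂ refl = ∈-++⁺ʳ (properDivisors n) (here refl)

∈-divisors⁻ : ∀ {n d} → d ∈ divisors n → d ∣ n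
∈-divisors⁻ {n} d∈ with ∈-++⁻ (properDivisors n) d∈
... | inj₁ d∈′        = proj₁ (∈-properDivisors⁻ d∈′)
... | inj₂ (here refl) = ∣-refl

unique-divisors : ∀ n → Unique (divisors n)
unique-divisors n = Unique.++⁺ (unique-properDivisors n) ([] ∷ [])
  λ { (n∈ , here refl) → <-irrefl refl (proj₂ (∈-properDivisors⁻ n∈)) }

update : ℕ → Bool → (ℕ → Bool) → ℕ → Bool
update a b f x = if does (x ≟ a) then b else f x

update-same : ∀ a b f → update a b f a ≡ b
update-same a b f rewrite dec-true (a ≟ a) refl = refl

update-other : ∀ a b f {x} → x ≢ a → update a b f x ≡ f x
update-other a b f {x} x≢a rewrite dec-false (x ≟ a) x≢a = refl

partSum-pair : ∀ h {v w R b c F} → h v ≡ b → h w ≡ c → partSum h R ≡ F →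
  partSum h (v ∷ w ∷ R) ≡ weight b v + (weight c w + F)
partSum-pair h {v} {w} {R} hv hw hR =
  trans (partSum-∷ h v (w ∷ R))
        (cong₂ _+_ (cong (λ b → weight b v) hv)
                   (trans (partSum-∷ h w R) (cong₂ (λ c F → weight c w + F) hw hR)))

double+ : ∀ v a → v * 2 + a ≡ v + (v + a)
double+ v a = begin
  v * 2 + a       ≡⟨ cong (_+ a) (trans (*-comm v 2) (cong (v +_) (+-identityʳ v))) ⟩
  v + v + a       ≡⟨ +-assoc v v a ⟩
  v + (v + a)     ∎

-- Arithmetic core of moving v across and adding w = 2v where v was:
-- the side that lost v gains 2v, so both sides grow by v.
absorb-arith : ∀ b {v w F F′} → w ≡ v * 2 → weight b v + F ≡ weight (not b) v + F′ →
  weight (not b) v + (weight b w + F) ≡ weight (not (not b)) v + (weight (not b) w + F′)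
absorb-arith true  {v} {F = F} {F′} refl bal = begin
  0 + (v * 2 + F)  ≡⟨ double+ v F ⟩
  v + (v + F)      ≡⟨ cong (v +_) bal ⟩
  v + (0 + F′)     ∎
absorb-arith false {v} {F = F} {F′} refl bal = begin
  v + (0 + F)      ≡⟨ cong (v +_) bal ⟩
  v + (v + F′)     ≡⟨ double+ v F′ ⟨
  0 + (v * 2 + F′) ∎

absorbDouble : ∀ {f v w R} → w ≡ v * 2 → w ≢ v → v ∉ R → w ∉ R → Balanced f (v ∷ R) →
  Balanced (update v (not (f v)) (update w (f v) f)) (v ∷ w ∷ R)
absorbDouble {f} {v} {w} {R} w≡2v w≢v v∉R w∉R bal = begin
  partSum g (v ∷ w ∷ R)
    ≡⟨ partSum-pair g gv gw (partSum-cong R g≡f) ⟩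
  weight (not (f v)) v + (weight (f v) w + partSum f R)
    ≡⟨ absorb-arith (f v) w≡2v balR ⟩
  weight (not (not (f v))) v + (weight (not (f v)) w + partSum f̅ R)
    ≡⟨ partSum-pair g̅ (cong not gv) (cong not gw) (partSum-cong R (λ x∈ → cong not (g≡f x∈))) ⟨
  partSum g̅ (v ∷ w ∷ R) ∎
  where
  g′ g f̅ g̅ : ℕ → Bool
  g′  = update w (f v) f
  g   = update v (not (f v)) g′
  f̅ x = not (f x)
  g̅ x = not (g x)
  gv : g v ≡ not (f v)
  gv = update-same v (not (f v)) g′
  gw : g w ≡ f v
  gw = trans (update-other v (not (f v)) g′ w≢v) (update-same w (f v) f)
  g≡f : ∀ {x} → x ∈ R → g x ≡ f x
  g≡f {x} x∈ = trans (update-other v (not (f v)) g′ (λ x≡v → v∉R (subst (_∈ R) x≡v x∈)))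
                     (update-other w (f v) f (λ x≡w → w∉R (subst (_∈ R) x≡w x∈)))
  balR : weight (f v) v + partSum f R ≡ weight (not (f v)) v + partSum f̅ R
  balR = trans (sym (partSum-∷ f v R)) (trans bal (partSum-∷ f̅ v R))

even⇒balancedDivisors : ∀ {n v f} → 1 ≤ n → n ≡ v * 2 → Balanced f (properDivisors n) →
  Σ (ℕ → Bool) λ g → Balanced g (divisors n)
even⇒balancedDivisors {n} {v} {f} n≥1 n≡2v bal =
  update v (not (f v)) (update n (f v) f) ,
  balanced-↭ (↭-sym divisors↭) (absorbDouble n≡2v (>⇒≢ v<n) v∉R n∉R (balanced-↭ D↭ bal))
  where
  R : List ℕ
  R = without v (properDivisors n)
  v≥1 : 1 ≤ v
  v≥1 = n≢0⇒n>0 λ v≡0 → contradiction (subst (1 ≤_) (trans n≡2v (cong (_* 2) v≡0)) n≥1) λ ()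
  v<n : v < n
  v<n = subst (v <_) (sym n≡2v) (m<m*n v 2 {{>-nonZero v≥1}} (s≤s (s≤s z≤n)))
  D↭ : properDivisors n ↭ v ∷ R
  D↭ = extract (unique-properDivisors n)
         (∈-properDivisors⁺ n≥1 (divides 2 (trans n≡2v (*-comm v 2))) v<n)
  divisors↭ : divisors n ↭ v ∷ n ∷ R
  divisors↭ = ↭-trans (++⁺ʳ [ n ] D↭) (prep v (++-comm R [ n ]))
  v∉R : v ∉ R
  v∉R v∈ = proj₂ (∈-without⁻ {xs = properDivisors n} v∈) refl
  n∉R : n ∉ R
  n∉R n∈ = <-irrefl refl (proj₂ (∈-properDivisors⁻ (proj₁ (∈-without⁻ {xs = properDivisors n} n∈))))

¬∣⇒coprime : ∀ {p x} → Prime p → ¬ p ∣ x → Coprime x p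
¬∣⇒coprime pp p∤x (i∣x , i∣p) with prime⇒irreducible pp i∣p
... | inj₁ i≡1 = i≡1
... | inj₂ refl = contradiction i∣x p∤x

coprime-∣-cancelPow : ∀ {x p m} j → Coprime x p → x ∣ m * p ^ j → x ∣ m
coprime-∣-cancelPow {x} {p} {m} zero    _     x∣ = subst (x ∣_) (*-identityʳ m) x∣
coprime-∣-cancelPow {x} {p} {m} (suc j) x⊥p x∣ =
  coprime-∣-cancelPow j x⊥p (coprime-divisor x⊥p (subst (x ∣_) (*-leftComm m p (p ^ j)) x∣))

module PrimePowers {p n : ℕ} (pp : Prime p) (p∤n : ¬ p ∣ n) (n≥1 : 1 ≤ n) where

  instance
    p≢0 : NonZero p
    p≢0 = prime⇒nonZero pp
    n≢0 : NonZero n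
    n≢0 = >-nonZero n≥1

  N≥1 : ∀ l → 1 ≤ n * p ^ l
  N≥1 l = *-mono-≤ n≥1 (m^n>0 p l)

  n*p^[1+l] : ∀ l → n * p ^ suc l ≡ p * (n * p ^ l)
  n*p^[1+l] l = *-leftComm n p (p ^ l)

  n<n*p^[1+l] : ∀ l → n < n * p ^ suc l
  n<n*p^[1+l] l = m<m*n n (p ^ suc l)
    (^-monoʳ-< p (nonTrivial⇒n>1 p {{prime⇒nonTrivial pp}}) {0} {suc l} z<s)

  properDivisors-step : ∀ l →
    properDivisors (n * p ^ suc l) ↭ divisors n ++ map (p *_) (properDivisors (n * p ^ l))
  properDivisors-step l = unique-↭ (unique-properDivisors (n * p ^ suc l)) unique-parts to from
    where
    N : ℕ
    N = n * p ^ l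
    coprimePart multiplePart : List ℕ
    coprimePart = divisors n
    multiplePart = map (p *_) (properDivisors N)

    -- The two parts are disjoint: p divides every element of the second only.
    unique-parts : Unique (coprimePart ++ multiplePart)
    unique-parts = Unique.++⁺ (unique-divisors n)
      (Unique.map⁺ (λ {x} {y} → *-cancelˡ-≡ x y p) (unique-properDivisors N))
      λ { (d∈ , py∈) → let (y , _ , d≡py) = ∈-map⁻ (p *_) py∈ in
            p∤n (∣-trans (subst (p ∣_) (sym d≡py) (m∣m*n y)) (∈-divisors⁻ d∈)) }

    -- A proper divisor x is either prime to p, or x = p y with y ∣ N, y < N.
    to : ∀ {x} → x ∈ properDivisors (n * p ^ suc l) → x ∈ coprimePart ++ multiplePart
    to {x} x∈ with ∈-properDivisors⁻ x∈ | p ∣? x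
    ... | x∣ , _  | no p∤x =
      ∈-++⁺ˡ (∈-divisors⁺ n≥1 (coprime-∣-cancelPow (suc l) (¬∣⇒coprime pp p∤x) x∣))
    ... | x∣ , x< | yes (divides y refl) =
      ∈-++⁺ʳ coprimePart (subst (_∈ multiplePart) (*-comm p y) (∈-map⁺ (p *_) y∈))
      where
      y∈ : y ∈ properDivisors N
      y∈ = ∈-properDivisors⁺ (N≥1 l)
             (*-cancelˡ-∣ p (subst₂ _∣_ (*-comm y p) (n*p^[1+l] l) x∣))
             (*-cancelˡ-< p y N (subst₂ _<_ (*-comm y p) (n*p^[1+l] l) x<))

    -- Conversely d ∣ n gives d ≤ n < n * p ^ (l + 1), and p * y scales y ∣ N, y < N.
    from : ∀ {x} → x ∈ coprimePart ++ multiplePart → x ∈ properDivisors (n * p ^ suc l)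
    from {x} x∈ with ∈-++⁻ coprimePart x∈
    ... | inj₁ d∈ = ∈-properDivisors⁺ (N≥1 (suc l))
                      (∣-trans (∈-divisors⁻ d∈) (m∣m*n (p ^ suc l)))
                      (≤-<-trans (∣⇒≤ (∈-divisors⁻ d∈)) (n<n*p^[1+l] l))
    ... | inj₂ py∈ with ∈-map⁻ (p *_) py∈
    ...   | y , y∈ , refl with ∈-properDivisors⁻ y∈
    ...     | y∣ , y< = ∈-properDivisors⁺ (N≥1 (suc l))
                          (subst (p * y ∣_) (sym (n*p^[1+l] l)) (*-monoʳ-∣ p y∣))
                          (subst (p * y <_) (sym (n*p^[1+l] l)) (*-monoʳ-< p y<))

  liftPartition : (ℕ → Bool) → (ℕ → Bool) → ℕ → Bool
  liftPartition g h x = if does (p ∣? x) then h (x / p) else g x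

  liftPartition-multiple : ∀ g h y → liftPartition g h (p * y) ≡ h y
  liftPartition-multiple g h y rewrite dec-true (p ∣? (p * y)) (m∣m*n y) =
    cong h (trans (cong (_/ p) (*-comm p y)) (m*n/n≡m y p))

  liftPartition-coprime : ∀ g h {x} → ¬ p ∣ x → liftPartition g h x ≡ g x
  liftPartition-coprime g h {x} p∤x rewrite dec-false (p ∣? x) p∤x = refl

  balanced-powers : ∀ {f g} → Balanced f (properDivisors n) → Balanced g (divisors n) →
    ∀ l → Σ (ℕ → Bool) λ h → Balanced h (properDivisors (n * p ^ l))
  balanced-powers {f} fBal gBal zero =
    f , subst (λ m → Balanced f (properDivisors m)) (sym (*-identityʳ n)) fBal
  balanced-powers {f} {g} fBal gBal (suc l) with balanced-powers fBal gBal l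
  ... | h , hBal = liftPartition g h , balanced-↭ (↭-sym (properDivisors-step l))
                     (balanced-++ {xs = divisors n} onCoprimePart onMultiplePart)
    where
    D : List ℕ
    D = properDivisors (n * p ^ l)
    p∤divisor : ∀ {d} → d ∈ divisors n → ¬ p ∣ d
    p∤divisor d∈ p∣d = p∤n (∣-trans p∣d (∈-divisors⁻ d∈))
    onCoprimePart : Balanced (liftPartition g h) (divisors n)
    onCoprimePart = balanced-cong (divisors n) (λ d∈ → sym (liftPartition-coprime g h (p∤divisor d∈))) gBal
    onMultiplePart : Balanced (liftPartition g h) (map (p *_) D)
    onMultiplePart = balanced-scale p D (balanced-cong D (λ {y} _ → sym (liftPartition-multiple g h y)) hBal)

-- The main theorem.
mainTheorem12 : (n p : ℕ) → HalfZumkeller n → 2 ∣ n → Prime p → gcd n p ≡ 1 →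
    (l : ℕ) → 1 ≤ l → HalfZumkeller (n * p ^ l)
mainTheorem12 n p (n≥1 , f , fBal) (divides v n≡2v) pp gcd≡1 l _ =
  N≥1 l , balanced-powers fBal (proj₂ (even⇒balancedDivisors {v = v} n≥1 n≡2v fBal)) l
  where
  -- A common divisor p of n and p would be 1, which is not prime.
  p∤n : ¬ p ∣ n
  p∤n p∣n = ¬prime[1] (subst Prime (gcd≡1⇒coprime gcd≡1 (p∣n , ∣-refl)) pp)
  open PrimePowers pp p∤n n≥1
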